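{- If $\Gamma \vdash \mathbb{M}:\tau$ and $\mathbb{M} \longrightarrow \mathbb{M}'$ then $\Gamma \vdash \mathbb{M}' :\tau$.
   Context: $\lambda_{\oplus}$ is the fragment of the resource calculus $\lambda^{\text{↯}}_{\oplus}$ without $\mathtt{fail}$: terms $M ::= x \mid \lambda x.M \mid M\,B \mid M\langle B/x\rangle$, bags (multisets) $B::=\mathtt{1}\mid[M]\mid B\cdot B$, expressions $\mathbb{M}$ are sums. Reduction: $(\lambda x.M)B\longrightarrow M\langle B/x\rangle$; if $\mathrm{head}(M)=x$, $B=[N_1]\cdots[N_k]$, $k\ge1$, $\#(x,M)=k$ then $M\langle B/x\rangle\longrightarrow\sum_i M\{\!|N_i/x|\!\}\langle(B\setminus N_i)/x\rangle$ (linear head substitution of $N_i$ for the head occurrence of $x$); plus closure under term contexts $[\cdot]B$, $[\cdot]\langle B/x\rangle$ and sum contexts. $\vdash$ is the non-idempotent intersection type system (strict types $\sigma::=\mathbf{unit}\mid\pi\to\sigma$, multiset types $\pi::=\bigwedge_i\sigma_i\mid\omega$) whose application and explicit-substitution rules require the bag's type $\sigma^k$ to match exactly the expected multiset type / number of occurrences, with weakening and a sum rule. -}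

module Defs where

open import Data.Nat using (ℕ; zero; suc; _+_; _≡ᵇ_; _<ᵇ_)
open import Data.Bool using (if_then_else_)
open import Data.Product using (Σ; _×_; _,_)
open import Data.List using (List; []; _∷_; _++_; replicate; length; map)
open import Data.List.NonEmpty using (List⁺; _∷_; toList)
import Data.List.NonEmpty as L⁺
open import Data.List.Relation.Unary.All using (All)
open import Data.List.Relation.Binary.Pointwise using (Pointwise)
open import Data.List.Relation.Binary.Permutation.Propositional using (_↭_)
open import Relation.Binary.PropositionalEquality using (_≡_)

-- Syntax of λ⊕ (locally nameless would also do; we use de Bruijn indices).
--   var n        : variable
--   lam M        : λx.M              (binds index 0 in M)
--   app M B      : M B
--   esub M B     : M⟨B/x⟩            (binds index 0 in M; B is outside the scope)
-- Bags are finite multisets of terms, represented as lists: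
--   []  is 1,  M ∷ B  is [M]·B.
-- Expressions are non-empty (formal) sums of terms, represented as List⁺.

mutual
  data Term : Set where
    var  : ℕ → Term
    lam  : Term → Term
    app  : Term → Bag → Term
    esub : Term → Bag → Term

  Bag : Set
  Bag = List Term

Expr : Set
Expr = List⁺ Term

mutual
  shiftFrom : ℕ → Term → Term
  shiftFrom c (var n)    = if n <ᵇ c then var n else var (suc n)
  shiftFrom c (lam M)    = lam (shiftFrom (suc c) M)
  shiftFrom c (app M B)  = app (shiftFrom c M) (shiftBag c B)
  shiftFrom c (esub M B) = esub (shiftFrom (suc c) M) (shiftBag c B)

  shiftBag : ℕ → Bag → Bag
  shiftBag c []      = []
  shiftBag c (M ∷ B) = shiftFrom c M ∷ shiftBag c B

shift : Term → Term
shift = shiftFrom 0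

mutual
  occ : ℕ → Term → ℕ
  occ x (var y)    = if y ≡ᵇ x then 1 else 0
  occ x (lam M)    = occ (suc x) M
  occ x (app M B)  = occ x M + occBag x B
  occ x (esub M B) = occ (suc x) M + occBag x B

  occBag : ℕ → Bag → ℕ
  occBag x []      = 0
  occBag x (M ∷ B) = occ x M + occBag x B

data HeadVar : Term → ℕ → Set where
  hv-var  : ∀ {x} → HeadVar (var x) x
  hv-app  : ∀ {M B x} → HeadVar M x → HeadVar (app M B) x
  hv-esub : ∀ {M B x} → HeadVar M (suc x) → HeadVar (esub M B) x

headSubst : Term → ℕ → Term → Term
headSubst (var y)    x N = if y ≡ᵇ x then N else var y
headSubst (lam M)    x N = lam M
headSubst (app M B)  x N = app (headSubst M x N) B
headSubst (esub M B) x N = esub (headSubst M (suc x) (shift N)) B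

picks : {A : Set} → List A → List (A × List A)
picks []       = []
picks (x ∷ xs) = (x , xs) ∷ map (λ { (y , ys) → (y , x ∷ ys) }) (picks xs)

picks⁺ : {A : Set} → A → List A → List⁺ (A × List A)
picks⁺ x xs = (x , xs) ∷ map (λ { (y , ys) → (y , x ∷ ys) }) (picks xs)

data _⟶ₜ_ : Term → Expr → Set where
  r-beta : ∀ {M B} → app (lam M) B ⟶ₜ (esub M B ∷ [])
  r-subst : ∀ {M N Ns} → HeadVar M 0 → occ 0 M ≡ length (N ∷ Ns) →
            esub M (N ∷ Ns) ⟶ₜ
              L⁺.map (λ { (P , R) → esub (headSubst M 0 (shift P)) R }) (picks⁺ N Ns)
  r-app   : ∀ {M 𝕄 B} → M ⟶ₜ 𝕄 → app M B ⟶ₜ L⁺.map (λ M' → app M' B) 𝕄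
  r-esub  : ∀ {M 𝕄 B} → M ⟶ₜ 𝕄 → esub M B ⟶ₜ L⁺.map (λ M' → esub M' B) 𝕄

data _⟶_ : Expr → Expr → Set where
  r-sum : ∀ {𝕄 𝕄' M 𝕄₀} (L R : List Term) → M ⟶ₜ 𝕄₀ →
          toList 𝕄  ≡ L ++ M ∷ R →
          toList 𝕄' ≡ L ++ toList 𝕄₀ ++ R →
          𝕄 ⟶ 𝕄'

-- Types.  Strict types σ ::= unit | π → σ ; multiset types π are finite
-- multisets of strict types, represented as lists ([] is ω) and compared
-- up to the multiset equality _≅ₘ_ below.

data Strict : Set where
  unit : Strict
  _⇒_  : List Strict → Strict → Strict

MType : Set
MType = List Strict

ω : MType
ω = []

_^_ : Strict → ℕ → MType
σ ^ k = replicate k σ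

mutual
  data _≅_ : Strict → Strict → Set where
    ≅-unit : unit ≅ unit
    ≅-arr  : ∀ {π π' σ σ'} → π ≅ₘ π' → σ ≅ σ' → (π ⇒ σ) ≅ (π' ⇒ σ')

  data _≅ₘ_ : MType → MType → Set where
    ≅ₘ-perm : ∀ {π ρ π'} → π ↭ ρ → Pointwise _≅_ ρ π' → π ≅ₘ π'

-- Typing contexts: maps from variables to multiset types; x : ω is
-- identified with x ∉ dom (so weakening Γ ⊢ M ⇒ Γ, x:ω ⊢ M is built in).

Ctx : Set
Ctx = ℕ → MType

∅ : Ctx
∅ _ = ω

⟨_∶_⟩ : ℕ → Strict → Ctx
⟨ x ∶ σ ⟩ y = if y ≡ᵇ x then σ ∷ [] else []

_◂_ : MType → Ctx → Ctx
(π ◂ Γ) zero    = π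
(π ◂ Γ) (suc n) = Γ n

_∧_ : Ctx → Ctx → Ctx
(Γ ∧ Δ) x = Γ x ++ Δ x

_≈_ : Ctx → Ctx → Set
Γ ≈ Δ = ∀ x → Γ x ≅ₘ Δ x

infix 4 _⊢_∶_ _⊢ᵇ_∶_ _⊢ₑ_∶_ _≈_ _≅_ _≅ₘ_
infixr 7 _⇒_
infixr 5 _◂_
infixl 6 _∧_
infix 8 _^_

-- Contexts and types are taken up to the
-- multiset equalities _≈_ / _≅_ / _≅ₘ_ (t-conv, b-conv and the Θ ≈ …
-- premises express only that the judgement is about equivalence classes).

mutual
  data _⊢_∶_ : Ctx → Term → Strict → Set where
    t-var  : ∀ {Θ x σ} → Θ ≈ ⟨ x ∶ σ ⟩ → Θ ⊢ var x ∶ σ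
    t-abs  : ∀ {Θ Γ M σ k τ} → Θ ⊢ M ∶ τ → Θ ≈ (σ ^ k ◂ Γ) →
             Γ ⊢ lam M ∶ (σ ^ k ⇒ τ)
    t-app  : ∀ {Θ Γ Δ M B σ k τ} → Γ ⊢ M ∶ (σ ^ k ⇒ τ) → Δ ⊢ᵇ B ∶ σ ^ k →
             Θ ≈ Γ ∧ Δ → Θ ⊢ app M B ∶ τ
    t-esub : ∀ {Θ Θ' Γ Δ M B σ k τ} → Θ' ⊢ M ∶ τ → Θ' ≈ (σ ^ k ◂ Γ) →
             Δ ⊢ᵇ B ∶ σ ^ k → Θ ≈ Γ ∧ Δ → Θ ⊢ esub M B ∶ τ
    t-conv : ∀ {Θ M σ σ'} → Θ ⊢ M ∶ σ → σ ≅ σ' → Θ ⊢ M ∶ σ'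

  data _⊢ᵇ_∶_ : Ctx → Bag → MType → Set where
    b-one  : ∀ {Θ} → Θ ≈ ∅ → Θ ⊢ᵇ [] ∶ ω
    b-bag  : ∀ {Θ Γ Δ M B σ k} → Γ ⊢ M ∶ σ → Δ ⊢ᵇ B ∶ σ ^ k →
             Θ ≈ Γ ∧ Δ → Θ ⊢ᵇ M ∷ B ∶ σ ^ suc k
    b-conv : ∀ {Θ B π π'} → Θ ⊢ᵇ B ∶ π → π ≅ₘ π' → Θ ⊢ᵇ B ∶ π'

data _⊢ₑ_∶_ : Ctx → Expr → Strict → Set where
  t-sum : ∀ {Γ 𝕄 σ} → All (λ M → Γ ⊢ M ∶ σ) (toList 𝕄) → Γ ⊢ₑ 𝕄 ∶ σ

-- Non-idempotent intersection types count resources: in Γ ⊢ M : τ the multiset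
-- Γ x has one component per free occurrence of x in M.  Linear head
-- substitution of N : σ for the head occurrence of x therefore consumes exactly
-- one σ from Γ x and adds the context of N.  For M⟨[N₁]⋯[Nₖ]/x⟩ typed with
-- Γ x ≅ σ^k, each summand M{|Nᵢ/x|}⟨(B ∖ Nᵢ)/x⟩ thus has σ^(k-1) left for x,
-- which is exactly the type of the bag B ∖ Nᵢ, and the contexts recombine by
-- commutativity of ∧.  A β-step merely turns an application into an explicit
-- substitution.
module Submission where

open import Defs
open import Data.Bool using (true; false; if_then_else_)
open import Data.Nat using (ℕ; zero; suc; _+_; _≡ᵇ_; _<ᵇ_)
open import Data.Nat.Properties using (suc-injective)
open import Data.Product using (∃-syntax; _×_; _,_; proj₁; proj₂)
open import Data.Sum using (_⊎_; inj₁; inj₂)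
open import Data.List using (List; []; _∷_; _++_; length)
import Data.List.Properties as List
open import Data.List.NonEmpty using (_∷_; toList)
open import Data.List.Relation.Unary.All as All using (All; []; _∷_)
import Data.List.Relation.Unary.All.Properties as All
open import Data.List.Relation.Binary.Pointwise as Pointwise using (Pointwise; []; _∷_)
open import Data.List.Relation.Binary.Permutation.Propositional
import Data.List.Relation.Binary.Permutation.Propositional.Properties as ↭
open import Relation.Binary.Bundles using (Setoid)
open import Relation.Binary.Definitions using (Reflexive; Symmetric; Transitive)
open import Relation.Binary.Structures using (IsEquivalence)
import Relation.Binary.Reasoning.Setoid as SetoidReasoning
open import Relation.Binary.PropositionalEquality as ≡
  using (_≡_; refl; sym; cong; subst)

Pointwise-↭-commute : ∀ {A : Set} {R : A → A → Set} {xs ys zs : List A} →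
  Pointwise R xs ys → ys ↭ zs → ∃[ ws ] xs ↭ ws × Pointwise R ws zs
Pointwise-↭-commute {xs = xs} rs refl = xs , refl , rs
Pointwise-↭-commute (r ∷ rs) (prep _ p) with Pointwise-↭-commute rs p
... | _ , p′ , rs′ = _ , prep _ p′ , r ∷ rs′
Pointwise-↭-commute (r ∷ s ∷ rs) (swap _ _ p) with Pointwise-↭-commute rs p
... | _ , p′ , rs′ = _ , swap _ _ p′ , s ∷ r ∷ rs′
Pointwise-↭-commute rs (trans p q) with Pointwise-↭-commute rs p
... | _ , p′ , rs′ with Pointwise-↭-commute rs′ q
... | _ , q′ , rs″ = _ , trans p′ q′ , rs″

-- The Pointwise lemmas are spelt out (instead of Pointwise.refl ≅-refl etc.)
-- so that the termination checker sees the structural recursion.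
mutual
  ≅-refl : Reflexive _≅_
  ≅-refl {unit}  = ≅-unit
  ≅-refl {_ ⇒ _} = ≅-arr ≅ₘ-refl ≅-refl

  ≅ₘ-refl : Reflexive _≅ₘ_
  ≅ₘ-refl = ≅ₘ-perm refl Pointwise-≅-refl

  Pointwise-≅-refl : Reflexive (Pointwise _≅_)
  Pointwise-≅-refl {[]}    = []
  Pointwise-≅-refl {_ ∷ _} = ≅-refl ∷ Pointwise-≅-refl

mutual
  ≅-sym : Symmetric _≅_
  ≅-sym ≅-unit      = ≅-unit
  ≅-sym (≅-arr p q) = ≅-arr (≅ₘ-sym p) (≅-sym q)

  ≅ₘ-sym : Symmetric _≅ₘ_
  ≅ₘ-sym (≅ₘ-perm p rs) with Pointwise-↭-commute (Pointwise-≅-sym rs) (↭-sym p)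
  ... | _ , p′ , rs′ = ≅ₘ-perm p′ rs′

  Pointwise-≅-sym : Symmetric (Pointwise _≅_)
  Pointwise-≅-sym []       = []
  Pointwise-≅-sym (r ∷ rs) = ≅-sym r ∷ Pointwise-≅-sym rs

-- In ≅ₘ-trans the pointwise proofs must be permuted before being composed,
-- which hides the structural recursion; so each a ≅ b is first turned into
-- "compose on the right with it", and only then permuted.
private
  PostComposable : Strict → Strict → Set
  PostComposable a b = ∀ {c} → b ≅ c → a ≅ c

mutual
  ≅-postCompose : ∀ {a b} → a ≅ b → PostComposable a b
  ≅-postCompose ≅-unit      ≅-unit        = ≅-unit
  ≅-postCompose (≅-arr p q) (≅-arr p′ q′) = ≅-arr (≅ₘ-trans p p′) (≅-postCompose q q′)

  ≅ₘ-trans : Transitive _≅ₘ_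
  ≅ₘ-trans (≅ₘ-perm p rs) (≅ₘ-perm q ss)
    with Pointwise-↭-commute (Pointwise-≅-postCompose rs) q
  ... | _ , q′ , rs′ = ≅ₘ-perm (trans p q′) (Pointwise.transitive (λ f g → f g) rs′ ss)

  Pointwise-≅-postCompose : ∀ {as bs} → Pointwise _≅_ as bs → Pointwise PostComposable as bs
  Pointwise-≅-postCompose []       = []
  Pointwise-≅-postCompose (r ∷ rs) = (λ {c} → ≅-postCompose r {c}) ∷ Pointwise-≅-postCompose rs

≅-trans : Transitive _≅_
≅-trans p = ≅-postCompose p

≅ₘ-isEquivalence : IsEquivalence _≅ₘ_
≅ₘ-isEquivalence = record { refl = ≅ₘ-refl ; sym = ≅ₘ-sym ; trans = ≅ₘ-trans }

≅ₘ-setoid : Setoid _ _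
≅ₘ-setoid = record { isEquivalence = ≅ₘ-isEquivalence }

++-swapʳ-↭ : ∀ {A : Set} (xs ys zs : List A) → (xs ++ ys) ++ zs ↭ (xs ++ zs) ++ ys
++-swapʳ-↭ xs ys zs = ↭-trans (↭.++-assoc xs ys zs)
  (↭-trans (↭.++⁺ˡ xs (↭.++-comm ys zs)) (↭-sym (↭.++-assoc xs zs ys)))

↭⇒≅ₘ : ∀ {π ρ} → π ↭ ρ → π ≅ₘ ρ
↭⇒≅ₘ p = ≅ₘ-perm p Pointwise-≅-refl

≡⇒≅ₘ : ∀ {π ρ} → π ≡ ρ → π ≅ₘ ρ
≡⇒≅ₘ refl = ≅ₘ-refl

≅ₘ-++ : ∀ {π π′ ρ ρ′} → π ≅ₘ π′ → ρ ≅ₘ ρ′ → π ++ ρ ≅ₘ π′ ++ ρ′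
≅ₘ-++ (≅ₘ-perm p rs) (≅ₘ-perm q ss) = ≅ₘ-perm (↭.++⁺ p q) (Pointwise.++⁺ rs ss)

≅ₘ-length : ∀ {π ρ} → π ≅ₘ ρ → length π ≡ length ρ
≅ₘ-length (≅ₘ-perm p rs) = ≡.trans (↭.↭-length p) (Pointwise.Pointwise-length rs)

All-≅-resp-≅ₘ : ∀ {σ π ρ} → All (_≅ σ) π → π ≅ₘ ρ → All (_≅ σ) ρ
All-≅-resp-≅ₘ a (≅ₘ-perm p rs) =
  Pointwise.All-resp-Pointwise (λ r s → ≅-trans (≅-sym r) s) rs (↭.All-resp-↭ p a)

All-≅-^ : ∀ {σ} n → All (_≅ σ) (σ ^ n)
All-≅-^ zero    = []
All-≅-^ (suc n) = ≅-refl ∷ All-≅-^ n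

≅ₘ-^⁻ : ∀ {σ π} n → π ≅ₘ σ ^ n → All (_≅ σ) π × length π ≡ n
≅ₘ-^⁻ n e = All-≅-resp-≅ₘ (All-≅-^ n) (≅ₘ-sym e) , ≡.trans (≅ₘ-length e) (List.length-replicate n)

≅ₘ-^⁺ : ∀ {σ π} → All (_≅ σ) π → π ≅ₘ σ ^ length π
≅ₘ-^⁺ a = ≅ₘ-perm refl (go a)
  where
  go : ∀ {σ π} → All (_≅ σ) π → Pointwise _≅_ π (σ ^ length π)
  go []      = []
  go (r ∷ a) = r ∷ go a

All-≅-agree : ∀ {σ τ π n} → All (_≅ σ) π → All (_≅ τ) π → length π ≡ suc n → σ ≅ τ
All-≅-agree (p ∷ _) (q ∷ _) _ = ≅-trans (≅-sym p) q

^-+ : ∀ σ m n → σ ^ m ++ σ ^ n ≡ σ ^ (m + n)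
^-+ σ zero    n = refl
^-+ σ (suc m) n = cong (σ ∷_) (^-+ σ m n)

≅ₘ-[] : ∀ {π} → π ≅ₘ [] → π ≡ []
≅ₘ-[] {[]}    _ = refl
≅ₘ-[] {_ ∷ _} e with ≅ₘ-length e
... | ()

≈-refl : ∀ {Γ} → Γ ≈ Γ
≈-refl _ = ≅ₘ-refl

≈-sym : ∀ {Γ Δ} → Γ ≈ Δ → Δ ≈ Γ
≈-sym e x = ≅ₘ-sym (e x)

≈-trans : ∀ {Γ Δ Θ} → Γ ≈ Δ → Δ ≈ Θ → Γ ≈ Θ
≈-trans e e′ x = ≅ₘ-trans (e x) (e′ x)

≡ᵇ-refl : ∀ x → (x ≡ᵇ x) ≡ true
≡ᵇ-refl zero    = refl
≡ᵇ-refl (suc x) = ≡ᵇ-refl x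

≡-or-≢ᵇ : ∀ y x → y ≡ x ⊎ (y ≡ᵇ x) ≡ false
≡-or-≢ᵇ zero    zero    = inj₁ refl
≡-or-≢ᵇ zero    (suc x) = inj₂ refl
≡-or-≢ᵇ (suc y) zero    = inj₂ refl
≡-or-≢ᵇ (suc y) (suc x) with ≡-or-≢ᵇ y x
... | inj₁ refl = inj₁ refl
... | inj₂ y≢x  = inj₂ y≢x

infixl 9 _[_≔_]

_[_≔_] : Ctx → ℕ → MType → Ctx
(Θ [ x ≔ π ]) y = if y ≡ᵇ x then π else Θ y

[≔]-here : ∀ Θ x π → (Θ [ x ≔ π ]) x ≡ π
[≔]-here Θ x π rewrite ≡ᵇ-refl x = refl

[≔]-there : ∀ Θ {x} π y → (y ≡ᵇ x) ≡ false → (Θ [ x ≔ π ]) y ≡ Θ y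
[≔]-there Θ π y y≢x rewrite y≢x = refl

[≔]-resp-≈ : ∀ {Γ Δ} x π → Γ ≈ Δ → Γ [ x ≔ π ] ≈ Δ [ x ≔ π ]
[≔]-resp-≈ {Γ} {Δ} x π e y with ≡-or-≢ᵇ y x
... | inj₁ refl = ≡⇒≅ₘ (≡.trans ([≔]-here Γ x π) (sym ([≔]-here Δ x π)))
... | inj₂ y≢x  = ≅ₘ-trans (≡⇒≅ₘ ([≔]-there Γ π y y≢x))
                    (≅ₘ-trans (e y) (≡⇒≅ₘ (sym ([≔]-there Δ π y y≢x))))

⟨∶⟩-there : ∀ {x} σ y → (y ≡ᵇ x) ≡ false → ⟨ x ∶ σ ⟩ y ≡ []
⟨∶⟩-there σ y y≢x rewrite y≢x = refl

shiftCtx : ℕ → Ctx → Ctx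
shiftCtx zero    Δ = [] ◂ Δ
shiftCtx (suc c) Δ = Δ 0 ◂ shiftCtx c (λ y → Δ (suc y))

shiftIndex : ℕ → ℕ → ℕ
shiftIndex c x = if x <ᵇ c then x else suc x

shiftFrom-var : ∀ c x → shiftFrom c (var x) ≡ var (shiftIndex c x)
shiftFrom-var c x with x <ᵇ c
... | true  = refl
... | false = refl

shiftIndex-suc : ∀ c x → shiftIndex (suc c) (suc x) ≡ suc (shiftIndex c x)
shiftIndex-suc c x with x <ᵇ c
... | true  = refl
... | false = refl

shiftCtx-resp-≈ : ∀ c {Γ Δ} → Γ ≈ Δ → shiftCtx c Γ ≈ shiftCtx c Δ
shiftCtx-resp-≈ zero    e zero    = ≅ₘ-refl
shiftCtx-resp-≈ zero    e (suc y) = e y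
shiftCtx-resp-≈ (suc c) e zero    = e 0
shiftCtx-resp-≈ (suc c) e (suc y) = shiftCtx-resp-≈ c (λ z → e (suc z)) y

shiftCtx-∅ : ∀ c y → shiftCtx c ∅ y ≡ []
shiftCtx-∅ zero    zero    = refl
shiftCtx-∅ zero    (suc y) = refl
shiftCtx-∅ (suc c) zero    = refl
shiftCtx-∅ (suc c) (suc y) = shiftCtx-∅ c y

shiftCtx-∧ : ∀ c Γ Δ y → shiftCtx c (Γ ∧ Δ) y ≡ (shiftCtx c Γ ∧ shiftCtx c Δ) y
shiftCtx-∧ zero    Γ Δ zero    = refl
shiftCtx-∧ zero    Γ Δ (suc y) = refl
shiftCtx-∧ (suc c) Γ Δ zero    = refl
shiftCtx-∧ (suc c) Γ Δ (suc y) = shiftCtx-∧ c (λ z → Γ (suc z)) (λ z → Δ (suc z)) y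

shiftCtx-⟨∶⟩ : ∀ c x σ y → shiftCtx c ⟨ x ∶ σ ⟩ y ≡ ⟨ shiftIndex c x ∶ σ ⟩ y
shiftCtx-⟨∶⟩ zero    x       σ zero    = refl
shiftCtx-⟨∶⟩ zero    x       σ (suc y) = refl
shiftCtx-⟨∶⟩ (suc c) zero    σ zero    = refl
shiftCtx-⟨∶⟩ (suc c) zero    σ (suc y) = shiftCtx-∅ c y
shiftCtx-⟨∶⟩ (suc c) (suc x) σ zero    rewrite shiftIndex-suc c x = refl
shiftCtx-⟨∶⟩ (suc c) (suc x) σ (suc y) rewrite shiftIndex-suc c x = shiftCtx-⟨∶⟩ c x σ y

shiftCtx-split : ∀ c {Θ Γ Δ} → Θ ≈ Γ ∧ Δ → shiftCtx c Θ ≈ shiftCtx c Γ ∧ shiftCtx c Δ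
shiftCtx-split c {Γ = Γ} {Δ} e y =
  ≅ₘ-trans (shiftCtx-resp-≈ c e y) (≡⇒≅ₘ (shiftCtx-∧ c Γ Δ y))

shiftCtx-bind : ∀ c {Θ π Γ} → Θ ≈ π ◂ Γ → shiftCtx (suc c) Θ ≈ π ◂ shiftCtx c Γ
shiftCtx-bind c e zero    = e 0
shiftCtx-bind c e (suc y) = shiftCtx-resp-≈ c (λ z → e (suc z)) y

mutual
  ⊢-shiftFrom : ∀ c {Θ M σ} → Θ ⊢ M ∶ σ → shiftCtx c Θ ⊢ shiftFrom c M ∶ σ
  ⊢-shiftFrom c {M = var x} {σ} (t-var e) rewrite shiftFrom-var c x =
    t-var (λ y → ≅ₘ-trans (shiftCtx-resp-≈ c e y) (≡⇒≅ₘ (shiftCtx-⟨∶⟩ c x σ y)))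
  ⊢-shiftFrom c (t-abs ⊢M e) = t-abs (⊢-shiftFrom (suc c) ⊢M) (shiftCtx-bind c e)
  ⊢-shiftFrom c (t-app ⊢M ⊢B e) =
    t-app (⊢-shiftFrom c ⊢M) (⊢ᵇ-shiftBag c ⊢B) (shiftCtx-split c e)
  ⊢-shiftFrom c (t-esub ⊢M e′ ⊢B e) =
    t-esub (⊢-shiftFrom (suc c) ⊢M) (shiftCtx-bind c e′) (⊢ᵇ-shiftBag c ⊢B) (shiftCtx-split c e)
  ⊢-shiftFrom c (t-conv ⊢M σ≅) = t-conv (⊢-shiftFrom c ⊢M) σ≅

  ⊢ᵇ-shiftBag : ∀ c {Θ B π} → Θ ⊢ᵇ B ∶ π → shiftCtx c Θ ⊢ᵇ shiftBag c B ∶ π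
  ⊢ᵇ-shiftBag c (b-one e) =
    b-one (λ y → ≅ₘ-trans (shiftCtx-resp-≈ c e y) (≡⇒≅ₘ (shiftCtx-∅ c y)))
  ⊢ᵇ-shiftBag c (b-bag ⊢M ⊢B e) = b-bag (⊢-shiftFrom c ⊢M) (⊢ᵇ-shiftBag c ⊢B) (shiftCtx-split c e)
  ⊢ᵇ-shiftBag c (b-conv ⊢B π≅) = b-conv (⊢ᵇ-shiftBag c ⊢B) π≅

⊢-shift : ∀ {Θ M σ} → Θ ⊢ M ∶ σ → [] ◂ Θ ⊢ shift M ∶ σ
⊢-shift = ⊢-shiftFrom 0

⊢-resp-≈ : ∀ {Θ Θ′ M τ} → Θ ≈ Θ′ → Θ ⊢ M ∶ τ → Θ′ ⊢ M ∶ τ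
⊢-resp-≈ e (t-var e′) = t-var (≈-trans (≈-sym e) e′)
⊢-resp-≈ e (t-abs ⊢M e′) = t-abs ⊢M λ where
  zero    → e′ 0
  (suc y) → ≅ₘ-trans (e′ (suc y)) (e y)
⊢-resp-≈ e (t-app ⊢M ⊢B e′) = t-app ⊢M ⊢B (≈-trans (≈-sym e) e′)
⊢-resp-≈ e (t-esub ⊢M e′ ⊢B e″) = t-esub ⊢M e′ ⊢B (≈-trans (≈-sym e) e″)
⊢-resp-≈ e (t-conv ⊢M τ≅) = t-conv (⊢-resp-≈ e ⊢M) τ≅

length-∧-suc : ∀ {Θ Γ Γ′ x n} → Θ ≈ Γ ∧ Γ′ → length (Γ x) ≡ suc n →
  length (Θ x) ≡ suc (n + length (Γ′ x))
length-∧-suc {Γ = Γ} {Γ′} {x} e |Γx|≡1+n =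
  ≡.trans (≅ₘ-length (e x)) (≡.trans (List.length-++ (Γ x)) (cong (_+ length (Γ′ x)) |Γx|≡1+n))

-- The occurrences of x in the argument part Γ′ of an application or explicit
-- substitution join those left over by the head substitution.
[≔]-∧-absorb : ∀ {Θ Γ Γ′ Δ x σ} n → Θ ≈ Γ ∧ Γ′ → All (_≅ σ) (Γ′ x) →
  Θ [ x ≔ σ ^ (n + length (Γ′ x)) ] ∧ Δ ≈ (Γ [ x ≔ σ ^ n ] ∧ Δ) ∧ Γ′
[≔]-∧-absorb {Θ} {Γ} {Γ′} {Δ} {x} {σ} n e a y with ≡-or-≢ᵇ y x
... | inj₁ refl = begin
  (Θ [ x ≔ σ ^ (n + length (Γ′ x)) ]) x ++ Δ x
    ≈⟨ ≡⇒≅ₘ (cong (_++ Δ x) (≡.trans ([≔]-here Θ x _) (sym (^-+ σ n (length (Γ′ x)))))) ⟩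
  (σ ^ n ++ σ ^ length (Γ′ x)) ++ Δ x
    ≈⟨ ↭⇒≅ₘ (++-swapʳ-↭ (σ ^ n) (σ ^ length (Γ′ x)) (Δ x)) ⟩
  (σ ^ n ++ Δ x) ++ σ ^ length (Γ′ x)
    ≈⟨ ≅ₘ-++ (≡⇒≅ₘ (cong (_++ Δ x) (sym ([≔]-here Γ x _)))) (≅ₘ-sym (≅ₘ-^⁺ a)) ⟩
  ((Γ [ x ≔ σ ^ n ]) x ++ Δ x) ++ Γ′ x ∎
  where open SetoidReasoning ≅ₘ-setoid
... | inj₂ y≢x = begin
  (Θ [ x ≔ _ ]) y ++ Δ y          ≈⟨ ≅ₘ-++ (≡⇒≅ₘ ([≔]-there Θ _ y y≢x)) ≅ₘ-refl ⟩
  Θ y ++ Δ y                      ≈⟨ ≅ₘ-++ (e y) ≅ₘ-refl ⟩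
  (Γ y ++ Γ′ y) ++ Δ y            ≈⟨ ↭⇒≅ₘ (++-swapʳ-↭ (Γ y) (Γ′ y) (Δ y)) ⟩
  (Γ y ++ Δ y) ++ Γ′ y            ≈⟨ ≅ₘ-++ (≅ₘ-++ (≡⇒≅ₘ (sym ([≔]-there Γ _ y y≢x))) ≅ₘ-refl) ≅ₘ-refl ⟩
  ((Γ [ x ≔ _ ]) y ++ Δ y) ++ Γ′ y ∎
  where open SetoidReasoning ≅ₘ-setoid

[≔]-under-binder : ∀ {Θ π Γ Δ} x ρ → Θ ≈ π ◂ Γ →
  Θ [ suc x ≔ ρ ] ∧ shiftCtx 0 Δ ≈ π ◂ (Γ [ x ≔ ρ ] ∧ Δ)
[≔]-under-binder x ρ e zero    = ≅ₘ-trans (≡⇒≅ₘ (List.++-identityʳ _)) (e 0)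
[≔]-under-binder x ρ e (suc y) = ≅ₘ-++ ([≔]-resp-≈ x ρ (λ z → e (suc z)) y) ≅ₘ-refl

[≔]-at-binder : ∀ {Θ π Γ Δ} ρ → Θ ≈ π ◂ Γ →
  Θ [ 0 ≔ ρ ] ∧ shiftCtx 0 Δ ≈ ρ ◂ (Γ ∧ Δ)
[≔]-at-binder ρ e zero    = ≡⇒≅ₘ (List.++-identityʳ ρ)
[≔]-at-binder ρ e (suc y) = ≅ₘ-++ (e (suc y)) ≅ₘ-refl

⊢-headSubst : ∀ {Θ M τ x σ Δ N} → Θ ⊢ M ∶ τ → HeadVar M x → All (_≅ σ) (Θ x) →
  Δ ⊢ N ∶ σ →
  ∃[ n ] length (Θ x) ≡ suc n × Θ [ x ≔ σ ^ n ] ∧ Δ ⊢ headSubst M x N ∶ τ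
⊢-headSubst {Θ} {τ = τ} {x} {Δ = Δ} (t-var e) hv-var a ⊢N
  rewrite ≡ᵇ-refl x
  with ≅ₘ-^⁻ 1 (≅ₘ-trans (e x) (≡⇒≅ₘ ([≔]-here ∅ x (τ ∷ []))))
... | aτ , |Θx|≡1 = 0 , |Θx|≡1 , ⊢-resp-≈ only-x (t-conv ⊢N (All-≅-agree a aτ |Θx|≡1))
  where
  only-x : Δ ≈ Θ [ x ≔ [] ] ∧ Δ
  only-x y with ≡-or-≢ᵇ y x
  ... | inj₁ refl = ≡⇒≅ₘ (cong (_++ Δ x) (sym ([≔]-here Θ x [])))
  ... | inj₂ y≢x  = ≡⇒≅ₘ (cong (_++ Δ y) (sym (≡.trans ([≔]-there Θ [] y y≢x)
                      (≅ₘ-[] (≅ₘ-trans (e y) (≡⇒≅ₘ (⟨∶⟩-there τ y y≢x)))))))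
⊢-headSubst {x = x} (t-app {Γ = Γ} {Δ = Γ′} ⊢M ⊢B e) (hv-app h) a ⊢N
  with All.++⁻ (Γ x) (All-≅-resp-≅ₘ a (e x))
... | aΓ , aΓ′ with ⊢-headSubst ⊢M h aΓ ⊢N
... | n , |Γx|≡1+n , ⊢M′ =
  n + length (Γ′ x) ,
  length-∧-suc {Γ = Γ} {Γ′} e |Γx|≡1+n ,
  t-app ⊢M′ ⊢B ([≔]-∧-absorb n e aΓ′)
⊢-headSubst {x = x} {σ} (t-esub {Γ = Γ} {Δ = Γ′} ⊢M e′ ⊢B e) (hv-esub h) a ⊢N
  with All.++⁻ (Γ x) (All-≅-resp-≅ₘ a (e x))
... | aΓ , aΓ′ with ⊢-headSubst ⊢M h (All-≅-resp-≅ₘ aΓ (≅ₘ-sym (e′ (suc x)))) (⊢-shift ⊢N)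
... | n , |Θ′x|≡1+n , ⊢M′ =
  n + length (Γ′ x) ,
  length-∧-suc {Γ = Γ} {Γ′} e (≡.trans (≅ₘ-length (≅ₘ-sym (e′ (suc x)))) |Θ′x|≡1+n) ,
  t-esub ⊢M′ ([≔]-under-binder x (σ ^ n) e′) ⊢B ([≔]-∧-absorb n e aΓ′)
⊢-headSubst (t-conv ⊢M τ≅) h a ⊢N with ⊢-headSubst ⊢M h a ⊢N
... | n , |Θx|≡1+n , ⊢M′ = n , |Θx|≡1+n , t-conv ⊢M′ τ≅

-- A bag all of whose elements have type σ, typed without the conversion rule;
-- this is Θ ⊢ᵇ B ∶ σ ^ length B up to ≅ₘ.
data _⊢ᵘ_∶_ : Ctx → Bag → Strict → Set where
  u-one : ∀ {Θ σ} → Θ ≈ ∅ → Θ ⊢ᵘ [] ∶ σ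
  u-bag : ∀ {Θ Γ Δ M B σ} → Γ ⊢ M ∶ σ → Δ ⊢ᵘ B ∶ σ → Θ ≈ Γ ∧ Δ → Θ ⊢ᵘ M ∷ B ∶ σ

⊢ᵘ-conv : ∀ {Θ B σ σ′} → σ ≅ σ′ → Θ ⊢ᵘ B ∶ σ → Θ ⊢ᵘ B ∶ σ′
⊢ᵘ-conv σ≅ (u-one e)        = u-one e
⊢ᵘ-conv σ≅ (u-bag ⊢M ⊢B e) = u-bag (t-conv ⊢M σ≅) (⊢ᵘ-conv σ≅ ⊢B) e

⊢ᵘ⇒⊢ᵇ : ∀ {Θ B σ} → Θ ⊢ᵘ B ∶ σ → Θ ⊢ᵇ B ∶ σ ^ length B
⊢ᵘ⇒⊢ᵇ (u-one e)        = b-one e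
⊢ᵘ⇒⊢ᵇ (u-bag ⊢M ⊢B e) = b-bag ⊢M (⊢ᵘ⇒⊢ᵇ ⊢B) e

⊢ᵇ⇒⊢ᵘ : ∀ {Θ B π σ} k → Θ ⊢ᵇ B ∶ π → π ≅ₘ σ ^ k → Θ ⊢ᵘ B ∶ σ × length B ≡ k
⊢ᵇ⇒⊢ᵘ k (b-one e) π≅ = u-one e , proj₂ (≅ₘ-^⁻ k π≅)
⊢ᵇ⇒⊢ᵘ k (b-bag {σ = σ′} {k = k′} ⊢M ⊢B e) π≅
  with ≅ₘ-^⁻ k π≅ | ⊢ᵇ⇒⊢ᵘ k′ ⊢B (≅ₘ-refl {σ′ ^ k′})
... | σ′≅σ ∷ _ , 1+k′≡k | ⊢ᵘB , |B|≡k′ =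
  u-bag (t-conv ⊢M σ′≅σ) (⊢ᵘ-conv σ′≅σ ⊢ᵘB) e ,
  ≡.trans (cong suc (≡.trans |B|≡k′ (sym (List.length-replicate k′)))) 1+k′≡k
⊢ᵇ⇒⊢ᵘ k (b-conv ⊢B π≅) π≅′ = ⊢ᵇ⇒⊢ᵘ k ⊢B (≅ₘ-trans π≅ π≅′)

record PickTyping (Θ : Ctx) (σ : Strict) (k : ℕ) (pick : Term × Bag) : Set where
  constructor pickTyping
  field
    {Γ Δ}   : Ctx
    ⊢picked : Γ ⊢ proj₁ pick ∶ σ
    ⊢rest   : Δ ⊢ᵘ proj₂ pick ∶ σ
    |rest|  : suc (length (proj₂ pick)) ≡ k
    split   : Θ ≈ Γ ∧ Δ

picks-typing : ∀ {Θ B σ} → Θ ⊢ᵘ B ∶ σ → All (PickTyping Θ σ (length B)) (picks B)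
picks-typing (u-one e) = []
picks-typing {Θ} {σ = σ} (u-bag {Γ = Γ} {Δ} {M} {B} ⊢M ⊢B e) =
  pickTyping ⊢M ⊢B refl e ∷ All.map⁺ (All.map keep-M (picks-typing ⊢B))
  where
  keep-M : ∀ {pick} → PickTyping Δ σ (length B) pick →
           PickTyping Θ σ (suc (length B)) (proj₁ pick , M ∷ proj₂ pick)
  keep-M (pickTyping {Γ′} {Δ′} ⊢N ⊢R |R| e′) =
    pickTyping ⊢N (u-bag ⊢M ⊢R ≈-refl) (cong suc |R|)
      (λ y → ≅ₘ-trans (e y) (≅ₘ-trans (≅ₘ-++ (≅ₘ-refl {Γ y}) (e′ y))
               (↭⇒≅ₘ (↭.shifts (Γ y) (Γ′ y)))))

lam-inversion : ∀ {Γ M ρ} → Γ ⊢ lam M ∶ ρ →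
  ∃[ Θ ] ∃[ σ ] ∃[ k ] ∃[ τ ] Θ ⊢ M ∶ τ × Θ ≈ σ ^ k ◂ Γ × (σ ^ k ⇒ τ) ≅ ρ
lam-inversion (t-abs ⊢M e) = _ , _ , _ , _ , ⊢M , e , ≅-refl
lam-inversion (t-conv ⊢λ ρ≅) with lam-inversion ⊢λ
... | Θ , σ , k , τ , ⊢M , e , ≅ρ = Θ , σ , k , τ , ⊢M , e , ≅-trans ≅ρ ρ≅

⊢-β : ∀ {Θ Γ Δ M B σ k τ} → Γ ⊢ lam M ∶ (σ ^ k ⇒ τ) → Δ ⊢ᵇ B ∶ σ ^ k → Θ ≈ Γ ∧ Δ →
  Θ ⊢ esub M B ∶ τ
⊢-β {Γ = Γ} {σ = σ} {k} ⊢λ ⊢B e with lam-inversion ⊢λ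
... | Θ′ , _ , _ , _ , ⊢M , e′ , ≅-arr π≅ τ≅ = t-conv (t-esub ⊢M e″ ⊢B e) τ≅
  where
  e″ : Θ′ ≈ σ ^ k ◂ Γ
  e″ zero    = ≅ₘ-trans (e′ 0) π≅
  e″ (suc y) = e′ (suc y)

⊢-linear-subst : ∀ {Θ Θ′ Γ Δ M N Ns σ k τ} →
  Θ′ ⊢ M ∶ τ → Θ′ ≈ σ ^ k ◂ Γ → Δ ⊢ᵇ N ∷ Ns ∶ σ ^ k → Θ ≈ Γ ∧ Δ → HeadVar M 0 →
  All (λ pick → Θ ⊢ esub (headSubst M 0 (shift (proj₁ pick))) (proj₂ pick) ∶ τ)
      (picks (N ∷ Ns))
⊢-linear-subst {Θ} {Γ = Γ} {Δ} {M} {Ns = Ns} {σ = σ} {k} {τ} ⊢M e′ ⊢B e h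
  with ⊢ᵇ⇒⊢ᵘ k ⊢B ≅ₘ-refl | ≅ₘ-^⁻ k (e′ 0)
... | ⊢ᵘB , |B|≡k | a , |Θ′0|≡k = All.map typing (picks-typing ⊢ᵘB)
  where
  typing : ∀ {pick} → PickTyping Δ σ (suc (length Ns)) pick →
           Θ ⊢ esub (headSubst M 0 (shift (proj₁ pick))) (proj₂ pick) ∶ τ
  typing {_ , R} (pickTyping {ΔN} {ΔR} ⊢N ⊢R |R| split)
    with ⊢-headSubst ⊢M h a (⊢-shift ⊢N)
  ... | n , |Θ′0|≡1+n , ⊢M′ =
    t-esub ⊢M′ ([≔]-at-binder (σ ^ n) e′) (subst (λ m → ΔR ⊢ᵇ R ∶ σ ^ m) |R|≡n (⊢ᵘ⇒⊢ᵇ ⊢R)) regroup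
    where
    |R|≡n : length R ≡ n
    |R|≡n = suc-injective (≡.trans |R| (≡.trans |B|≡k (≡.trans (sym |Θ′0|≡k) |Θ′0|≡1+n)))
    regroup : Θ ≈ (Γ ∧ ΔN) ∧ ΔR
    regroup y = ≅ₘ-trans (e y) (≅ₘ-trans (≅ₘ-++ (≅ₘ-refl {Γ y}) (split y))
                  (≡⇒≅ₘ (sym (List.++-assoc (Γ y) (ΔN y) (ΔR y)))))

subject-reductionₜ : ∀ {Θ M τ 𝕄} → Θ ⊢ M ∶ τ → M ⟶ₜ 𝕄 → All (Θ ⊢_∶ τ) (toList 𝕄)
subject-reductionₜ (t-conv ⊢M τ≅) step =
  All.map (λ ⊢M′ → t-conv ⊢M′ τ≅) (subject-reductionₜ ⊢M step)
subject-reductionₜ (t-app ⊢λ ⊢B e) r-beta = ⊢-β ⊢λ ⊢B e ∷ []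
subject-reductionₜ (t-esub ⊢M e′ ⊢B e) (r-subst h _) = All.map⁺ (⊢-linear-subst ⊢M e′ ⊢B e h)
subject-reductionₜ {𝕄 = _ ∷ _} (t-app ⊢M ⊢B e) (r-app step) =
  All.map⁺ (All.map (λ ⊢M′ → t-app ⊢M′ ⊢B e) (subject-reductionₜ ⊢M step))
subject-reductionₜ {𝕄 = _ ∷ _} (t-esub ⊢M e′ ⊢B e) (r-esub step) =
  All.map⁺ (All.map (λ ⊢M′ → t-esub ⊢M′ e′ ⊢B e) (subject-reductionₜ ⊢M step))

theorem2p20 : ∀ {Γ 𝕄 𝕄' τ} → Γ ⊢ₑ 𝕄 ∶ τ → 𝕄 ⟶ 𝕄' → Γ ⊢ₑ 𝕄' ∶ τ
theorem2p20 {Γ} {τ = τ} (t-sum ⊢𝕄) (r-sum L R step 𝕄≡ 𝕄'≡)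
  with All.++⁻ L (subst (All (Γ ⊢_∶ τ)) 𝕄≡ ⊢𝕄)
... | ⊢L , ⊢M ∷ ⊢R =
  t-sum (subst (All (Γ ⊢_∶ τ)) (sym 𝕄'≡)
    (All.++⁺ ⊢L (All.++⁺ (subject-reductionₜ ⊢M step) ⊢R)))
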